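{- Let $G=(V,E)$ be a graph with $|E|=m\ge1$, let $\Omega$ be the set of all matchings of $G$, and let $\lambda>0$. Consider the coupled process $(\sigma_t,\eta_t)$ on $\Omega\times\Omega$ defined as follows: at each step choose one edge $e$ uniformly at random from $E$ (the same edge for both copies). Say insertion of $e$ is possible in a matching $\sigma$ if $\sigma\cup\{e\}$ is a matching (this is the case in particular if $e\in\sigma$). (1) If insertion of $e$ is possible in both $\sigma_t$ and $\eta_t$, then with probability $\frac{\lambda}{1+\lambda}$ set $\sigma_{t+1}=\sigma_t\cup\{e\}$, $\eta_{t+1}=\eta_t\cup\{e\}$, and with probability $\frac{1}{1+\lambda}$ set $\sigma_{t+1}=\sigma_t\setminus\{e\}$, $\eta_{t+1}=\eta_t\setminus\{e\}$. (2) If insertion of $e$ is possible in exactly one of $\sigma_t,\eta_t$, then remove $e$ from whichever of the two matchings contains it (and leave the other unchanged). (3) Otherwise both states stay unchanged. Let $\Phi(\sigma,\eta)=|(\sigma\setminus\eta)\cup(\eta\setminus\sigma)|$. Then $$\mathbb{E}[\Phi(\sigma_{t+1},\eta_{t+1})]=\Phi(\sigma_t,\eta_t)\left(1-\frac{1}{m}\right).$$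
   Context: A matching is a set of edges no two of which share an endpoint.
   Formalization: The parameter λ ranges only over the positive rationals. -}

module Defs where

open import Data.Nat as ℕ using (ℕ; zero; suc)
open import Data.Fin using (Fin)
open import Data.Fin.Properties using (all?) renaming (_≟_ to _≟ᶠ_)
open import Data.Fin.Subset using (Subset; _∈_; _∉_; _∪_; _─_; _-_; ⁅_⁆; ∣_∣)
open import Data.Fin.Subset.Properties using (_∈?_)
open import Data.Sum using (_⊎_)
open import Data.Product using (_×_; _,_; proj₁; proj₂)
open import Data.List using (List; []; _∷_; foldr; map; allFin)
open import Data.Integer using (+_)
open import Data.Rational using (ℚ; _+_; _*_; _/_; 1/_; 0ℚ; 1ℚ; _<_; NonZero; Positive; positive)
  renaming (_-_ to _-ℚ_)
open import Data.Rational.Properties using (pos+pos⇒pos; pos⇒nonZero)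
open import Relation.Nullary using (Dec; yes; no; ¬_; ¬?; does)
open import Relation.Nullary.Decidable using (_×-dec_; _→-dec_)
open import Relation.Binary.PropositionalEquality using (_≡_; _≢_)
open import Data.Bool using (if_then_else_)

record Graph (n m : ℕ) : Set where
  field
    ends      : Fin m → Fin n × Fin n
    loopless  : ∀ e → proj₁ (ends e) ≢ proj₂ (ends e)
    noParallel : ∀ e f →
      ((proj₁ (ends e) ≡ proj₁ (ends f) × proj₂ (ends e) ≡ proj₂ (ends f))
        ⊎
       (proj₁ (ends e) ≡ proj₂ (ends f) × proj₂ (ends e) ≡ proj₁ (ends f)))
      → e ≡ f
open Graph public

module _ {n m : ℕ} (G : Graph n m) where

  Disjoint : Fin m → Fin m → Set
  Disjoint e f =
    (proj₁ (ends G e) ≢ proj₁ (ends G f)) × (proj₁ (ends G e) ≢ proj₂ (ends G f)) ×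
    (proj₂ (ends G e) ≢ proj₁ (ends G f)) × (proj₂ (ends G e) ≢ proj₂ (ends G f))

  IsMatching : Subset m → Set
  IsMatching σ = ∀ e f → e ∈ σ → f ∈ σ → e ≢ f → Disjoint e f

  disjoint? : ∀ e f → Dec (Disjoint e f)
  disjoint? e f =
    ¬? (proj₁ (ends G e) ≟ᶠ proj₁ (ends G f)) ×-dec ¬? (proj₁ (ends G e) ≟ᶠ proj₂ (ends G f)) ×-dec
    ¬? (proj₂ (ends G e) ≟ᶠ proj₁ (ends G f)) ×-dec ¬? (proj₂ (ends G e) ≟ᶠ proj₂ (ends G f))

  isMatching? : ∀ σ → Dec (IsMatching σ)
  isMatching? σ = all? λ e → all? λ f →
    (e ∈? σ) →-dec ((f ∈? σ) →-dec (¬? (e ≟ᶠ f) →-dec disjoint? e f))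

  InsertionPossible : Subset m → Fin m → Set
  InsertionPossible σ e = IsMatching (σ ∪ ⁅ e ⁆)

  insertionPossible? : ∀ σ e → Dec (InsertionPossible σ e)
  insertionPossible? σ e = isMatching? (σ ∪ ⁅ e ⁆)

  Φ : Subset m → Subset m → ℕ
  Φ σ η = ∣ (σ ─ η) ∪ (η ─ σ) ∣

ℕ→ℚ : ℕ → ℚ
ℕ→ℚ k = (+ k) / 1

sumℚ : List ℚ → ℚ
sumℚ = foldr _+_ 0ℚ

1+λ-nonZero : (λ′ : ℚ) → 0ℚ < λ′ → NonZero (1ℚ + λ′)
1+λ-nonZero λ′ 0<λ = pos⇒nonZero (1ℚ + λ′) {{pos+pos⇒pos 1ℚ {{_}} λ′ {{positive 0<λ}}}}

module Coupling {n m : ℕ} (G : Graph n m) (λ′ : ℚ) (0<λ : 0ℚ < λ′) where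

  private
    instance
      nz : NonZero (1ℚ + λ′)
      nz = 1+λ-nonZero λ′ 0<λ

  -- one step of the coupled chain, given the chosen edge e:
  -- the finite distribution of successor pairs, as (probability , (σ' , η'))
  step : Subset m → Subset m → Fin m → List (ℚ × (Subset m × Subset m))
  step σ η e with insertionPossible? G σ e | insertionPossible? G η e
  ... | yes _ | yes _ =
        (λ′ * (1/ (1ℚ + λ′)) , (σ ∪ ⁅ e ⁆ , η ∪ ⁅ e ⁆)) ∷
        (1/ (1ℚ + λ′) , (σ - e , η - e)) ∷ []
  ... | yes _ | no _ = (1ℚ , removeFromContainer) ∷ []
    where
    removeFromContainer : Subset m × Subset m
    removeFromContainer = if does (e ∈? σ) then (σ - e , η) else
                          (if does (e ∈? η) then (σ , η - e) else (σ , η))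
  ... | no _ | yes _ = (1ℚ , removeFromContainer) ∷ []
    where
    removeFromContainer : Subset m × Subset m
    removeFromContainer = if does (e ∈? σ) then (σ - e , η) else
                          (if does (e ∈? η) then (σ , η - e) else (σ , η))
  ... | no _ | no _ = (1ℚ , (σ , η)) ∷ []

  expectedΦ : .{{ℕ.NonZero m}} → Subset m → Subset m → ℚ
  expectedΦ σ η =
    sumℚ (map (λ e → ((+ 1) / m) * sumℚ
                       (map (λ { (p , (σ′ , η′)) → p * ℕ→ℚ (Φ G σ′ η′) }) (step σ η e)))
              (allFin m))

{-# OPTIONS --safe #-}
-- Fix the chosen edge e. A matching containing e admits the insertion of e, so
-- rule (2) only removes e from one matching when the other lacks it, and rule (3)
-- only applies when neither contains e. Hence every outcome of the step is
-- (σ ∪ {e}, η ∪ {e}) or (σ − e, η − e), and both have Φ = Φ(σ, η) − [e ∈ σ Δ η].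
-- Averaging over e, each edge of σ Δ η is lost exactly once: E Φ' = Φ − Φ/m.
module Submission where

open import Defs
open import Data.Nat using (ℕ; _≤_; >-nonZero)
open import Data.Fin.Subset using (Subset)
open import Data.Integer using (+_)
open import Data.Rational using (ℚ; _*_; _-_; _/_; 0ℚ; 1ℚ; _<_)
open import Relation.Binary.PropositionalEquality using (_≡_)

open import Algebra.Bundles using (CommutativeRing)
open import Data.Bool using (Bool; true; false; if_then_else_)
open import Data.Bool.Properties using (∨-zeroʳ; ∨-identityʳ)
open import Data.Fin using (Fin; zero; suc)
open import Data.Fin.Subset using (_─_; _∪_; ⁅_⁆; ∣_∣; _∈_; _∉_; inside; outside)
  renaming (_-_ to _−_)
open import Data.Fin.Subset.Properties using (_∈?_; p─⊥≡p; ∪-identityʳ)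
open import Data.List using (List; []; _∷_; map; tabulate; allFin)
open import Data.List.Properties using (map-tabulate)
open import Data.List.Relation.Unary.All as All using (All; []; _∷_)
import Data.Nat as ℕ
import Data.Nat.Properties as ℕ
open import Data.Nat.Coprimality using (1-coprimeTo)
import Data.Nat.Coprimality as Coprime
import Data.Integer as ℤ
import Data.Integer.Properties as ℤ
import Data.Rational as ℚ
import Data.Rational.Properties as ℚ
open import Data.Rational.Solver using (module +-*-Solver)
open import Data.Product using (_×_; _,_; proj₁; proj₂)
open import Data.Sum using (_⊎_; inj₁; inj₂)
open import Data.Vec using (_∷_; []; lookup; _[_]≔_; here; there)
open import Data.Vec.Properties using ([]=⇒lookup; []≔-lookup)
open import Function using (_∘_)
open import Relation.Nullary using (¬_; yes; no; does)
open import Relation.Nullary.Negation using (contradiction)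
open import Relation.Binary.PropositionalEquality
  using (refl; sym; trans; cong; cong₂; subst; module ≡-Reasoning)
open import Algebra.Properties.CommutativeMonoid.Sum ℕ.+-0-commutativeMonoid
  using () renaming (sum to ∑ℕ; ∑-distrib-+ to ∑ℕ-distrib-+; sum-cong-≗ to ∑ℕ-cong)
open import Algebra.Properties.Semiring.Sum (CommutativeRing.semiring ℚ.+-*-commutativeRing)
  using () renaming (sum to ∑ℚ; *-distribˡ-sum to *-distribˡ-∑ℚ; sum-cong-≗ to ∑ℚ-cong)

∑ℕ-const : ∀ m k → ∑ℕ {m} (λ _ → k) ≡ m ℕ.* k
∑ℕ-const ℕ.zero    k = refl
∑ℕ-const (ℕ.suc m) k = cong (k ℕ.+_) (∑ℕ-const m k)

sumℚ-tabulate : ∀ {m} (f : Fin m → ℚ) → sumℚ (tabulate f) ≡ ∑ℚ f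
sumℚ-tabulate {ℕ.zero}  f = refl
sumℚ-tabulate {ℕ.suc m} f = cong (f zero ℚ.+_) (sumℚ-tabulate (f ∘ suc))

sumℚ-allFin : ∀ {m} (f : Fin m → ℚ) → sumℚ (map f (allFin m)) ≡ ∑ℚ f
sumℚ-allFin f = trans (cong sumℚ (map-tabulate (λ i → i) f)) (sumℚ-tabulate f)

sumℚ-weighted-const : ∀ {A : Set} (h : ℚ × A → ℚ) (c : ℚ) {xs : List (ℚ × A)} →
  All (λ q → h q ≡ proj₁ q * c) xs → sumℚ (map h xs) ≡ sumℚ (map proj₁ xs) * c
sumℚ-weighted-const h c [] = sym (ℚ.*-zeroˡ c)
sumℚ-weighted-const h c {(p , _) ∷ xs} (hq ∷ hs) =
  trans (cong₂ ℚ._+_ hq (sumℚ-weighted-const h c hs))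
        (sym (ℚ.*-distribʳ-+ c p (sumℚ (map proj₁ xs))))

ℕ→ℚ≡mkℚ : ∀ k → ℕ→ℚ k ≡ ℚ.mkℚ (+ k) 0 (Coprime.sym (1-coprimeTo k))
ℕ→ℚ≡mkℚ k = ℚ.normalize-coprime (Coprime.sym (1-coprimeTo k))

ℕ→ℚ-+ : ∀ a b → ℕ→ℚ (a ℕ.+ b) ≡ ℕ→ℚ a ℚ.+ ℕ→ℚ b
ℕ→ℚ-+ a b rewrite ℕ→ℚ≡mkℚ a | ℕ→ℚ≡mkℚ b =
  cong (_/ 1) (trans (ℤ.pos-+ a b)
                     (sym (cong₂ ℤ._+_ (ℤ.*-identityʳ (+ a)) (ℤ.*-identityʳ (+ b)))))

ℕ→ℚ-* : ∀ a b → ℕ→ℚ (a ℕ.* b) ≡ ℕ→ℚ a ℚ.* ℕ→ℚ b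
ℕ→ℚ-* a b rewrite ℕ→ℚ≡mkℚ a | ℕ→ℚ≡mkℚ b = cong (_/ 1) (ℤ.pos-* a b)

ℕ→ℚ-∑ : ∀ {m} (k : Fin m → ℕ) → ℕ→ℚ (∑ℕ k) ≡ ∑ℚ (ℕ→ℚ ∘ k)
ℕ→ℚ-∑ {ℕ.zero}  k = refl
ℕ→ℚ-∑ {ℕ.suc m} k =
  trans (ℕ→ℚ-+ (k zero) (∑ℕ (k ∘ suc))) (cong (ℕ→ℚ (k zero) ℚ.+_) (ℕ→ℚ-∑ (k ∘ suc)))

1/n*n≡1 : ∀ n .{{_ : ℕ.NonZero n}} → (+ 1 / n) ℚ.* ℕ→ℚ n ≡ 1ℚ
1/n*n≡1 (ℕ.suc k) rewrite ℕ→ℚ≡mkℚ (ℕ.suc k)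
                        | ℚ.normalize-coprime {1} {k} (1-coprimeTo (ℕ.suc k)) =
  ℚ.*-inverseˡ (ℚ.mkℚ (+ ℕ.suc k) 0 (Coprime.sym (1-coprimeTo (ℕ.suc k))))

c*S≡P*[1-c] : ∀ c M S P → c * M ≡ 1ℚ → S ℚ.+ P ≡ M * P → c * S ≡ P * (1ℚ - c)
c*S≡P*[1-c] c M S P cM≡1 S+P≡MP = begin
  c * S                      ≡⟨ solve 3 (λ c S P → c :* S := c :* (S :+ P) :- c :* P) refl c S P ⟩
  c * (S ℚ.+ P) - c * P      ≡⟨ cong (λ x → c * x - c * P) S+P≡MP ⟩
  c * (M * P) - c * P        ≡⟨ cong (_- c * P) (sym (ℚ.*-assoc c M P)) ⟩
  c * M * P - c * P          ≡⟨ cong (λ x → x * P - c * P) cM≡1 ⟩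
  1ℚ * P - c * P             ≡⟨ solve 2 (λ c P → con 1ℚ :* P :- c :* P := P :* (con 1ℚ :- c)) refl c P ⟩
  P * (1ℚ - c)               ∎
  where open ≡-Reasoning
        open +-*-Solver

symDiff : ∀ {m} → Subset m → Subset m → Subset m
symDiff s t = (s ─ t) ∪ (t ─ s)

differ : Bool → Bool → ℕ
differ true  false = 1
differ false true  = 1
differ _     _     = 0

mismatch : ∀ {m} → Subset m → Subset m → Fin m → ℕ
mismatch s t i = differ (lookup s i) (lookup t i)

∣symDiff-∷∣ : ∀ {m} a b (s t : Subset m) →
  ∣ symDiff (a ∷ s) (b ∷ t) ∣ ≡ differ a b ℕ.+ ∣ symDiff s t ∣
∣symDiff-∷∣ true  true  s t = refl
∣symDiff-∷∣ true  false s t = refl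
∣symDiff-∷∣ false true  s t = refl
∣symDiff-∷∣ false false s t = refl

∣symDiff∣≡∑mismatch : ∀ {m} (s t : Subset m) → ∣ symDiff s t ∣ ≡ ∑ℕ (mismatch s t)
∣symDiff∣≡∑mismatch []      []      = refl
∣symDiff∣≡∑mismatch (a ∷ s) (b ∷ t) =
  trans (∣symDiff-∷∣ a b s t) (cong (differ a b ℕ.+_) (∣symDiff∣≡∑mismatch s t))

∣symDiff-[]≔∣ : ∀ {m} (s t : Subset m) i b →
  ∣ symDiff (s [ i ]≔ b) (t [ i ]≔ b) ∣ ℕ.+ mismatch s t i ≡ ∣ symDiff s t ∣
∣symDiff-[]≔∣ (a ∷ s) (a′ ∷ t) zero b = begin
  ∣ symDiff (b ∷ s) (b ∷ t) ∣ ℕ.+ differ a a′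
    ≡⟨ cong (ℕ._+ differ a a′) (∣symDiff-∷∣ b b s t) ⟩
  differ b b ℕ.+ ∣ symDiff s t ∣ ℕ.+ differ a a′
    ≡⟨ cong (λ d → d ℕ.+ ∣ symDiff s t ∣ ℕ.+ differ a a′) (differ-self b) ⟩
  ∣ symDiff s t ∣ ℕ.+ differ a a′
    ≡⟨ ℕ.+-comm ∣ symDiff s t ∣ (differ a a′) ⟩
  differ a a′ ℕ.+ ∣ symDiff s t ∣
    ≡⟨ sym (∣symDiff-∷∣ a a′ s t) ⟩
  ∣ symDiff (a ∷ s) (a′ ∷ t) ∣ ∎
  where
  open ≡-Reasoning
  differ-self : ∀ b → differ b b ≡ 0
  differ-self true  = refl
  differ-self false = refl
∣symDiff-[]≔∣ (a ∷ s) (a′ ∷ t) (suc i) b = begin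
  ∣ symDiff (a ∷ s [ i ]≔ b) (a′ ∷ t [ i ]≔ b) ∣ ℕ.+ mismatch s t i
    ≡⟨ cong (ℕ._+ mismatch s t i) (∣symDiff-∷∣ a a′ (s [ i ]≔ b) (t [ i ]≔ b)) ⟩
  differ a a′ ℕ.+ ∣ symDiff (s [ i ]≔ b) (t [ i ]≔ b) ∣ ℕ.+ mismatch s t i
    ≡⟨ ℕ.+-assoc (differ a a′) _ _ ⟩
  differ a a′ ℕ.+ (∣ symDiff (s [ i ]≔ b) (t [ i ]≔ b) ∣ ℕ.+ mismatch s t i)
    ≡⟨ cong (differ a a′ ℕ.+_) (∣symDiff-[]≔∣ s t i b) ⟩
  differ a a′ ℕ.+ ∣ symDiff s t ∣
    ≡⟨ sym (∣symDiff-∷∣ a a′ s t) ⟩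
  ∣ symDiff (a ∷ s) (a′ ∷ t) ∣ ∎
  where open ≡-Reasoning

p∪⁅x⁆≡p[x]≔inside : ∀ {m} (p : Subset m) x → p ∪ ⁅ x ⁆ ≡ p [ x ]≔ inside
p∪⁅x⁆≡p[x]≔inside (a ∷ p) zero    = cong₂ _∷_ (∨-zeroʳ a) (∪-identityʳ p)
p∪⁅x⁆≡p[x]≔inside (a ∷ p) (suc x) = cong₂ _∷_ (∨-identityʳ a) (p∪⁅x⁆≡p[x]≔inside p x)

p−x≡p[x]≔outside : ∀ {m} (p : Subset m) x → p − x ≡ p [ x ]≔ outside
p−x≡p[x]≔outside (a ∷ p) zero    = cong (outside ∷_) (p─⊥≡p p)
p−x≡p[x]≔outside (a ∷ p) (suc x) = cong (a ∷_) (p−x≡p[x]≔outside p x)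

x∈p⇒p∪⁅x⁆≡p : ∀ {m} {p : Subset m} {x} → x ∈ p → p ∪ ⁅ x ⁆ ≡ p
x∈p⇒p∪⁅x⁆≡p {p = p} {x} x∈p =
  trans (p∪⁅x⁆≡p[x]≔inside p x) (trans (cong (p [ x ]≔_) (sym ([]=⇒lookup x∈p))) ([]≔-lookup p x))

x∉p⇒p−x≡p : ∀ {m} {p : Subset m} {x} → x ∉ p → p − x ≡ p
x∉p⇒p−x≡p {p = inside  ∷ p} {zero}  x∉p = contradiction here x∉p
x∉p⇒p−x≡p {p = outside ∷ p} {zero}  x∉p = cong (outside ∷_) (p─⊥≡p p)
x∉p⇒p−x≡p {p = a       ∷ p} {suc x} x∉p = cong (a ∷_) (x∉p⇒p−x≡p (x∉p ∘ there))

∣symDiff-remove∣+mismatch : ∀ {m} (s t : Subset m) i →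
  ∣ symDiff (s − i) (t − i) ∣ ℕ.+ mismatch s t i ≡ ∣ symDiff s t ∣
∣symDiff-remove∣+mismatch s t i
  rewrite p−x≡p[x]≔outside s i | p−x≡p[x]≔outside t i = ∣symDiff-[]≔∣ s t i outside

∣symDiff-insert∣≡∣symDiff-remove∣ : ∀ {m} (s t : Subset m) i →
  ∣ symDiff (s ∪ ⁅ i ⁆) (t ∪ ⁅ i ⁆) ∣ ≡ ∣ symDiff (s − i) (t − i) ∣
∣symDiff-insert∣≡∣symDiff-remove∣ s t i = ℕ.+-cancelʳ-≡ (mismatch s t i) _ _ (begin
  ∣ symDiff (s ∪ ⁅ i ⁆) (t ∪ ⁅ i ⁆) ∣ ℕ.+ mismatch s t i
    ≡⟨ cong₂ (λ s′ t′ → ∣ symDiff s′ t′ ∣ ℕ.+ mismatch s t i)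
             (p∪⁅x⁆≡p[x]≔inside s i) (p∪⁅x⁆≡p[x]≔inside t i) ⟩
  ∣ symDiff (s [ i ]≔ inside) (t [ i ]≔ inside) ∣ ℕ.+ mismatch s t i
    ≡⟨ ∣symDiff-[]≔∣ s t i inside ⟩
  ∣ symDiff s t ∣
    ≡⟨ sym (∣symDiff-remove∣+mismatch s t i) ⟩
  ∣ symDiff (s − i) (t − i) ∣ ℕ.+ mismatch s t i ∎)
  where open ≡-Reasoning

∑∣symDiff-remove∣ : ∀ {m} (s t : Subset m) →
  ∑ℕ (λ i → ∣ symDiff (s − i) (t − i) ∣) ℕ.+ ∣ symDiff s t ∣ ≡ m ℕ.* ∣ symDiff s t ∣
∑∣symDiff-remove∣ {m} s t = begin
  ∑ℕ (λ i → ∣ symDiff (s − i) (t − i) ∣) ℕ.+ ∣ symDiff s t ∣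
    ≡⟨ cong (∑ℕ (λ i → ∣ symDiff (s − i) (t − i) ∣) ℕ.+_) (∣symDiff∣≡∑mismatch s t) ⟩
  ∑ℕ (λ i → ∣ symDiff (s − i) (t − i) ∣) ℕ.+ ∑ℕ (mismatch s t)
    ≡⟨ sym (∑ℕ-distrib-+ (λ i → ∣ symDiff (s − i) (t − i) ∣) (mismatch s t)) ⟩
  ∑ℕ (λ i → ∣ symDiff (s − i) (t − i) ∣ ℕ.+ mismatch s t i)
    ≡⟨ ∑ℕ-cong (∣symDiff-remove∣+mismatch s t) ⟩
  ∑ℕ {m} (λ _ → ∣ symDiff s t ∣)
    ≡⟨ ∑ℕ-const m ∣ symDiff s t ∣ ⟩
  m ℕ.* ∣ symDiff s t ∣ ∎
  where open ≡-Reasoning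

-- Definitionally the outcome of rule (2) in Coupling.step.
removeFromContainer : ∀ {m} → Subset m → Subset m → Fin m → Subset m × Subset m
removeFromContainer σ η e = if does (e ∈? σ) then (σ − e , η) else
                            (if does (e ∈? η) then (σ , η − e) else (σ , η))

removeFromContainer≡removeBoth : ∀ {m} {σ η : Subset m} {e} → e ∉ σ ⊎ e ∉ η →
  removeFromContainer σ η e ≡ (σ − e , η − e)
removeFromContainer≡removeBoth {σ = σ} {η} {e} e∉σ⊎e∉η with e ∈? σ | e ∈? η | e∉σ⊎e∉η
... | yes e∈σ | _       | inj₁ e∉σ = contradiction e∈σ e∉σ
... | yes _   | _       | inj₂ e∉η = cong (σ − e ,_) (sym (x∉p⇒p−x≡p e∉η))
... | no e∉σ  | yes _   | _        = cong (_, η − e) (sym (x∉p⇒p−x≡p e∉σ))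
... | no e∉σ  | no e∉η  | _        = sym (cong₂ _,_ (x∉p⇒p−x≡p e∉σ) (x∉p⇒p−x≡p e∉η))

module _ {n m : ℕ} (G : Graph n m) where

  ¬insertionPossible⇒∉ : ∀ {σ e} → IsMatching G σ → ¬ InsertionPossible G σ e → e ∉ σ
  ¬insertionPossible⇒∉ σ-matching ¬possible e∈σ =
    ¬possible (subst (IsMatching G) (sym (x∈p⇒p∪⁅x⁆≡p e∈σ)) σ-matching)

  module _ (λ′ : ℚ) (0<λ : 0ℚ < λ′) where
    open Coupling G λ′ 0<λ

    InsertsOrRemovesBoth : Subset m → Subset m → Fin m → Subset m × Subset m → Set
    InsertsOrRemovesBoth σ η e o = o ≡ (σ ∪ ⁅ e ⁆ , η ∪ ⁅ e ⁆) ⊎ o ≡ (σ − e , η − e)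

    step-insertsOrRemovesBoth : ∀ {σ η} e → IsMatching G σ → IsMatching G η →
      All (InsertsOrRemovesBoth σ η e ∘ proj₂) (step σ η e)
    step-insertsOrRemovesBoth {σ} {η} e σ-matching η-matching
      with insertionPossible? G σ e | insertionPossible? G η e
    ... | yes _ | yes _ = inj₁ refl ∷ inj₂ refl ∷ []
    ... | yes _ | no ¬possible =
      inj₂ (removeFromContainer≡removeBoth (inj₂ (¬insertionPossible⇒∉ η-matching ¬possible))) ∷ []
    ... | no ¬possible | yes _ =
      inj₂ (removeFromContainer≡removeBoth (inj₁ (¬insertionPossible⇒∉ σ-matching ¬possible))) ∷ []
    ... | no ¬possibleσ | no ¬possibleη =
      inj₂ (sym (cong₂ _,_ (x∉p⇒p−x≡p (¬insertionPossible⇒∉ σ-matching ¬possibleσ))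
                           (x∉p⇒p−x≡p (¬insertionPossible⇒∉ η-matching ¬possibleη)))) ∷ []

    step-probabilities : ∀ σ η e → sumℚ (map proj₁ (step σ η e)) ≡ 1ℚ
    step-probabilities σ η e with insertionPossible? G σ e | insertionPossible? G η e
    ... | yes _ | yes _ = begin
      λ′ * r ℚ.+ (r ℚ.+ 0ℚ)  ≡⟨ solve 2 (λ l r → l :* r :+ (r :+ con 0ℚ) := (con 1ℚ :+ l) :* r) refl λ′ r ⟩
      (1ℚ ℚ.+ λ′) * r        ≡⟨ ℚ.*-inverseʳ (1ℚ ℚ.+ λ′) ⟩
      1ℚ                     ∎
      where
      open ≡-Reasoning
      open +-*-Solver
      instance _ = 1+λ-nonZero λ′ 0<λ
      r = ℚ.1/ (1ℚ ℚ.+ λ′)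
    ... | yes _ | no _  = ℚ.+-identityʳ 1ℚ
    ... | no _  | yes _ = ℚ.+-identityʳ 1ℚ
    ... | no _  | no _  = ℚ.+-identityʳ 1ℚ

    weightedΦ : ℚ × (Subset m × Subset m) → ℚ
    weightedΦ (p , (σ′ , η′)) = p * ℕ→ℚ (Φ G σ′ η′)

    stepExpectedΦ : Subset m → Subset m → Fin m → ℚ
    stepExpectedΦ σ η e = sumℚ (map weightedΦ (step σ η e))

    stepExpectedΦ≡Φ-removeBoth : ∀ {σ η} e → IsMatching G σ → IsMatching G η →
      stepExpectedΦ σ η e ≡ ℕ→ℚ (Φ G (σ − e) (η − e))
    stepExpectedΦ≡Φ-removeBoth {σ} {η} e σ-matching η-matching = begin
      sumℚ (map weightedΦ (step σ η e))
        ≡⟨ sumℚ-weighted-const weightedΦ K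
             (All.map (λ {q} → weight-K {q}) (step-insertsOrRemovesBoth e σ-matching η-matching)) ⟩
      sumℚ (map proj₁ (step σ η e)) * K  ≡⟨ cong (_* K) (step-probabilities σ η e) ⟩
      1ℚ * K                             ≡⟨ ℚ.*-identityˡ K ⟩
      K                                  ∎
      where
      open ≡-Reasoning
      K = ℕ→ℚ (Φ G (σ − e) (η − e))
      weight-K : ∀ {q} → InsertsOrRemovesBoth σ η e (proj₂ q) → weightedΦ q ≡ proj₁ q * K
      weight-K {p , _} (inj₁ refl) = cong (λ k → p * ℕ→ℚ k) (∣symDiff-insert∣≡∣symDiff-remove∣ σ η e)
      weight-K {_ , _} (inj₂ refl) = refl

    expectedΦ≡∑Φ-removeBoth : .{{_ : ℕ.NonZero m}} → ∀ {σ η} → IsMatching G σ → IsMatching G η →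
      expectedΦ σ η ≡ (+ 1 / m) * ℕ→ℚ (∑ℕ (λ e → Φ G (σ − e) (η − e)))
    expectedΦ≡∑Φ-removeBoth {σ} {η} σ-matching η-matching = begin
      sumℚ (map (λ e → c * stepExpectedΦ σ η e) (allFin m))
        ≡⟨ sumℚ-allFin (λ e → c * stepExpectedΦ σ η e) ⟩
      ∑ℚ (λ e → c * stepExpectedΦ σ η e)
        ≡⟨ ∑ℚ-cong (λ e → cong (c *_) (stepExpectedΦ≡Φ-removeBoth e σ-matching η-matching)) ⟩
      ∑ℚ (λ e → c * ℕ→ℚ (Φ G (σ − e) (η − e)))
        ≡⟨ sym (*-distribˡ-∑ℚ c (λ e → ℕ→ℚ (Φ G (σ − e) (η − e)))) ⟩
      c * ∑ℚ (λ e → ℕ→ℚ (Φ G (σ − e) (η − e)))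
        ≡⟨ cong (c *_) (sym (ℕ→ℚ-∑ (λ e → Φ G (σ − e) (η − e)))) ⟩
      c * ℕ→ℚ (∑ℕ (λ e → Φ G (σ − e) (η − e))) ∎
      where
      open ≡-Reasoning
      c = + 1 / m

mainTheorem3 : (n m : ℕ) (G : Graph n m) (m≥1 : 1 ≤ m)
    (λ′ : ℚ) (0<λ : 0ℚ < λ′)
    (σ η : Subset m) → IsMatching G σ → IsMatching G η →
    Coupling.expectedΦ G λ′ 0<λ {{>-nonZero m≥1}} σ η
      ≡ ℕ→ℚ (Φ G σ η) * (1ℚ - _/_ (+ 1) m {{>-nonZero m≥1}})
mainTheorem3 n m G m≥1 λ′ 0<λ σ η σ-matching η-matching =
  trans (expectedΦ≡∑Φ-removeBoth G λ′ 0<λ σ-matching η-matching)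
        (c*S≡P*[1-c] (+ 1 / m) (ℕ→ℚ m) (ℕ→ℚ S) (ℕ→ℚ P) (1/n*n≡1 m) S+P≡m*P)
  where
  instance _ = >-nonZero m≥1
  S = ∑ℕ (λ e → Φ G (σ − e) (η − e))
  P = Φ G σ η
  S+P≡m*P : ℕ→ℚ S ℚ.+ ℕ→ℚ P ≡ ℕ→ℚ m * ℕ→ℚ P
  S+P≡m*P = trans (sym (ℕ→ℚ-+ S P)) (trans (cong ℕ→ℚ (∑∣symDiff-remove∣ σ η)) (ℕ→ℚ-* m P))
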